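{- Let $\mathcal{A}$ be a splitting class. Then there exists a p-morphism $\alpha:(\mathcal{A},\le_T)\to 2^{<\omega}$, where $2^{<\omega}$ is the set of finite binary strings ordered by the prefix relation.
   Context: For $f,g\in\omega^\omega$, $f\oplus g$ is the join: $(f\oplus g)(2n)=f(n)$, $(f\oplus g)(2n+1)=g(n)$. "Countable" includes finite. A non-empty countable class $\mathcal{A}\subseteq\omega^\omega$ which is downwards closed under Turing reducibility is a splitting class if for every $f\in\mathcal{A}$ and every finite subset $\mathcal{B}\subseteq\{g\in\mathcal{A}\mid g\not\le_T f\}$ there exist $h_0,h_1\in\mathcal{A}$ such that $h_0,h_1\ge_T f$, $h_0\oplus h_1\notin\mathcal{A}$, and for all $g\in\mathcal{B}$: $g\oplus h_0\notin\mathcal{A}$ and $g\oplus h_1\notin\mathcal{A}$. For (pre)ordered sets $(X_1,\le_1)$, $(X_2,\le_2)$, a surjective map $f:X_1\to X_2$ is a p-morphism if (1) $x\le_1 y$ implies $f(x)\le_2 f(y)$, and (2) for all $x\in X_1$ and $y\in X_2$ with $f(x)\le_2 y$ there exists $z\in X_1$ with $x\le_1 z$ and $f(z)=y$. -}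

module Defs where

open import Data.Nat using (ℕ; zero; suc; _<_)
open import Data.Fin using (Fin)
open import Data.Vec using (Vec; []; _∷_; lookup)
open import Data.List using (List)
open import Data.List.Relation.Unary.All using (All)
open import Data.List.Relation.Binary.Prefix.Heterogeneous using (Prefix)
open import Data.Bool using (Bool)
open import Data.Product using (Σ; ∃; _×_; proj₁)
open import Data.Sum using (_⊎_)
open import Relation.Nullary using (¬_)
open import Relation.Binary.PropositionalEquality using (_≡_)

Baire : Set
Baire = ℕ → ℕ

-- Oracle μ-recursive functions (Kleene): codes of partial functions
-- ℕ^n ⇀ ℕ built from zero, successor, projections, one oracle call,
-- composition, primitive recursion and unbounded minimisation.

data Code : ℕ → Set where
  zeroC   : ∀ {n} → Code n
  succC   : Code 1
  projC   : ∀ {n} → Fin n → Code n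
  oracleC : Code 1
  compC   : ∀ {m n} → Code m → Vec (Code n) m → Code n
  precC   : ∀ {n} → Code n → Code (suc (suc n)) → Code (suc n)
  muC     : ∀ {n} → Code (suc n) → Code n

mutual
  data Eval (o : Baire) : ∀ {n} → Code n → Vec ℕ n → ℕ → Set where
    evZero   : ∀ {n} {xs : Vec ℕ n} → Eval o zeroC xs 0
    evSucc   : ∀ {x} → Eval o succC (x ∷ []) (suc x)
    evProj   : ∀ {n} {i : Fin n} {xs} → Eval o (projC i) xs (lookup xs i)
    evOracle : ∀ {x} → Eval o oracleC (x ∷ []) (o x)
    evComp   : ∀ {m n} {f : Code m} {gs : Vec (Code n) m} {xs ys y} →
               EvalVec o gs xs ys → Eval o f ys y → Eval o (compC f gs) xs y
    evPrec0  : ∀ {n} {g : Code n} {h xs y} →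
               Eval o g xs y → Eval o (precC g h) (0 ∷ xs) y
    evPrecS  : ∀ {n} {g : Code n} {h xs x r y} →
               Eval o (precC g h) (x ∷ xs) r → Eval o h (x ∷ r ∷ xs) y →
               Eval o (precC g h) (suc x ∷ xs) y
    evMu     : ∀ {n} {c : Code (suc n)} {xs y} →
               Eval o c (y ∷ xs) 0 →
               ((z : ℕ) → z < y → Σ ℕ λ k → Eval o c (z ∷ xs) (suc k)) →
               Eval o (muC c) xs y

  data EvalVec (o : Baire) {n : ℕ} : ∀ {m} → Vec (Code n) m → Vec ℕ n → Vec ℕ m → Set where
    []  : ∀ {xs} → EvalVec o [] xs []
    _∷_ : ∀ {m} {g : Code n} {gs : Vec (Code n) m} {xs y ys} →
          Eval o g xs y → EvalVec o gs xs ys → EvalVec o (g ∷ gs) xs (y ∷ ys)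

_≤T_ : Baire → Baire → Set
f ≤T g = Σ (Code 1) λ c → (n : ℕ) → Eval g c (n ∷ []) (f n)

-- The join f ⊕ g: (f ⊕ g)(2n) = f n, (f ⊕ g)(2n+1) = g n.
_⊕_ : Baire → Baire → Baire
(f ⊕ g) zero = f 0
(f ⊕ g) (suc zero) = g 0
(f ⊕ g) (suc (suc n)) = ((λ k → f (suc k)) ⊕ (λ k → g (suc k))) n

Class : Set₁
Class = Baire → Set

-- countable (finite allowed): either empty, or enumerated by ℕ
-- (each member is pointwise equal to some enumerated element)
Countable : Class → Set
Countable A = (∀ f → ¬ A f) ⊎
  Σ (ℕ → Baire) λ e → ((n : ℕ) → A (e n)) ×
    ((f : Baire) → A f → Σ ℕ λ n → (k : ℕ) → e n k ≡ f k)

NonEmpty : Class → Set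
NonEmpty A = ∃ λ f → A f

DownClosed : Class → Set
DownClosed A = ∀ f g → A g → f ≤T g → A f

-- Splitting class (finite subsets B given as lists)
IsSplittingClass : Class → Set
IsSplittingClass A =
  NonEmpty A × Countable A × DownClosed A ×
  ((f : Baire) → A f → (B : List Baire) →
    All (λ g → A g × ¬ (g ≤T f)) B →
    Σ Baire λ h₀ → Σ Baire λ h₁ →
      A h₀ × A h₁ × f ≤T h₀ × f ≤T h₁ × ¬ A (h₀ ⊕ h₁) ×
      All (λ g → ¬ A (g ⊕ h₀) × ¬ A (g ⊕ h₁)) B)

record IsPMorphism {X₁ X₂ : Set} (_≤₁_ : X₁ → X₁ → Set) (_≤₂_ : X₂ → X₂ → Set)
                   (α : X₁ → X₂) : Set where
  field
    surjective : (y : X₂) → Σ X₁ λ x → α x ≡ y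
    monotone   : (x y : X₁) → x ≤₁ y → α x ≤₂ α y
    back       : (x : X₁) (y : X₂) → α x ≤₂ y → Σ X₁ λ z → (x ≤₁ z) × (α z ≡ y)

Elem : Class → Set
Elem A = Σ Baire A

ElemLe : (A : Class) → Elem A → Elem A → Set
ElemLe A x y = proj₁ x ≤T proj₁ y

BinStr : Set
BinStr = List Bool

_≼_ : BinStr → BinStr → Set
s ≼ t = Prefix _≡_ s t

-- Enumerate 𝒜 as e₀, e₁, … and build a list of markers: pairs (a, τ) of
-- an element of 𝒜 and a string. The label of x is the string of the most
-- recently placed marker below x (or [] if there is none). At stage n let
-- σₙ be the current label of eₙ; the splitting property gives two elements
-- k₀, k₁ above eₙ that have no common upper bound in 𝒜, and neither has one
-- with any earlier element not below eₙ. They become markers labelled σₙ0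
-- and σₙ1. Such markers are never below earlier elements, so the label of
-- every x is eventually constant, and this limit is α(x). Monotonicity
-- holds because incompatible markers never lie below a common element of
-- 𝒜, and the back condition because the markers placed at x's own stage
-- lie above x and realise both one-bit extensions of α(x).
module Submission where

open import Defs
open import Level using (0ℓ)
open import Axiom.ExcludedMiddle using (ExcludedMiddle)
open import Data.Bool using (Bool; true; false; if_then_else_)
open import Data.Empty using (⊥; ⊥-elim)
open import Data.Fin using (#_)
open import Data.List using (List; []; _∷_; _++_; _∷ʳ_; filter)
open import Data.List.Properties using (++-assoc; ++-identityʳ)
open import Data.List.Membership.Propositional using (_∈_)
open import Data.List.Membership.Propositional.Properties using (∈-filter⁺)
open import Data.List.Relation.Unary.All as All using (All; []; _∷_)
open import Data.List.Relation.Unary.All.Properties using (all-filter; filter⁺)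
open import Data.List.Relation.Unary.Any using (here; there)
import Data.List.Relation.Binary.Pointwise.Properties as Pointwise
open import Data.List.Relation.Binary.Prefix.Heterogeneous using ([]; _++ᵖ_)
import Data.List.Relation.Binary.Prefix.Heterogeneous.Properties as Prefix
open import Data.List.Relation.Binary.Prefix.Propositional.Properties using (Prefix-as-∣ˡ)
open import Algebra.Definitions.RawMagma using (_,_)
open import Data.Nat using (ℕ; zero; suc; _+_; _⊔_; _≤′_; ≤′-refl; ≤′-step)
open import Data.Nat.Properties using (+-comm; +-identityʳ; ≤⇒≤′; m≤m⊔n; m≤n⊔m)
open import Data.Product using (Σ; _×_; _,_; proj₁; proj₂)
open import Data.Sum using (_⊎_; inj₁; inj₂)
open import Data.Vec using (Vec; []; _∷_)
open import Function using (_∘_)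
open import Relation.Nullary using (¬_; yes; no)
open import Relation.Nullary.Decidable using (¬?)
open import Relation.Unary using (Decidable)
open import Relation.Binary.PropositionalEquality
  using (_≡_; _≗_; refl; sym; trans; cong; subst; subst₂)
import Relation.Binary.PropositionalEquality as ≡

private
  variable
    f g h : Baire

≤T-refl : f ≤T f
≤T-refl = oracleC , λ n → evOracle

≗⇒≤T : f ≗ g → f ≤T g
≗⇒≤T {g = g} f≗g = oracleC , λ n → subst (Eval g oracleC (n ∷ [])) (sym (f≗g n)) evOracle

mutual
  plugOracle : ∀ {n} → Code 1 → Code n → Code n
  plugOracle d zeroC        = zeroC
  plugOracle d succC        = succC
  plugOracle d (projC i)    = projC i
  plugOracle d oracleC      = d
  plugOracle d (compC c cs) = compC (plugOracle d c) (plugOracleVec d cs)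
  plugOracle d (precC c c′) = precC (plugOracle d c) (plugOracle d c′)
  plugOracle d (muC c)      = muC (plugOracle d c)

  plugOracleVec : ∀ {n m} → Code 1 → Vec (Code n) m → Vec (Code n) m
  plugOracleVec d []       = []
  plugOracleVec d (c ∷ cs) = plugOracle d c ∷ plugOracleVec d cs

module _ {d : Code 1} (d-computes-g : (n : ℕ) → Eval h d (n ∷ []) (g n)) where
  mutual
    eval-plugOracle : ∀ {n} {c : Code n} {xs y} → Eval g c xs y → Eval h (plugOracle d c) xs y
    eval-plugOracle evZero            = evZero
    eval-plugOracle evSucc            = evSucc
    eval-plugOracle evProj            = evProj
    eval-plugOracle (evOracle {x})    = d-computes-g x
    eval-plugOracle (evComp es e)     = evComp (evalVec-plugOracle es) (eval-plugOracle e)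
    eval-plugOracle (evPrec0 e)       = evPrec0 (eval-plugOracle e)
    eval-plugOracle (evPrecS e e′)    = evPrecS (eval-plugOracle e) (eval-plugOracle e′)
    eval-plugOracle (evMu e below)    = evMu (eval-plugOracle e) (λ z z<y → eval-plugOracle-suc (below z z<y))

    eval-plugOracle-suc : ∀ {n} {c : Code n} {xs} →
      Σ ℕ (λ k → Eval g c xs (suc k)) → Σ ℕ (λ k → Eval h (plugOracle d c) xs (suc k))
    eval-plugOracle-suc (k , e) = k , eval-plugOracle e

    evalVec-plugOracle : ∀ {n m} {cs : Vec (Code n) m} {xs ys} →
      EvalVec g cs xs ys → EvalVec h (plugOracleVec d cs) xs ys
    evalVec-plugOracle []       = []
    evalVec-plugOracle (e ∷ es) = eval-plugOracle e ∷ evalVec-plugOracle es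

≤T-trans : f ≤T g → g ≤T h → f ≤T h
≤T-trans (c , c-computes-f) (d , d-computes-g) =
  plugOracle d c , λ n → eval-plugOracle d-computes-g (c-computes-f n)

isZero : ℕ → ℕ
isZero zero    = 1
isZero (suc _) = 0

parity : ℕ → ℕ
parity zero    = 0
parity (suc n) = isZero (parity n)

half : ℕ → ℕ
half zero    = 0
half (suc n) = half n + parity n

ifZero : ℕ → ℕ → ℕ → ℕ
ifZero zero    a _ = a
ifZero (suc _) _ b = b

parity≡0⊎1 : (n : ℕ) → parity n ≡ 0 ⊎ parity n ≡ 1
parity≡0⊎1 zero = inj₁ refl
parity≡0⊎1 (suc n) with parity n | parity≡0⊎1 n
... | _ | inj₁ refl = inj₂ refl
... | _ | inj₂ refl = inj₁ refl

parity-2+ : (n : ℕ) → parity (suc (suc n)) ≡ parity n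
parity-2+ n with parity n | parity≡0⊎1 n
... | _ | inj₁ refl = refl
... | _ | inj₂ refl = refl

half-2+ : (n : ℕ) → half (suc (suc n)) ≡ suc (half n)
half-2+ n with parity n | parity≡0⊎1 n
... | _ | inj₁ refl = trans (+-comm (half n + 0) 1) (cong suc (+-identityʳ (half n)))
... | _ | inj₂ refl = trans (+-identityʳ (half n + 1)) (+-comm (half n) 1)

⊕-as-ifZero : (f g : Baire) (n : ℕ) → (f ⊕ g) n ≡ ifZero (parity n) (f (half n)) (g (half n))
⊕-as-ifZero f g zero          = refl
⊕-as-ifZero f g (suc zero)    = refl
⊕-as-ifZero f g (suc (suc n)) rewrite parity-2+ n | half-2+ n =
  ⊕-as-ifZero (λ k → f (suc k)) (λ k → g (suc k)) n

isZeroC parityC halfC : Code 1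
isZeroC = precC (compC succC (zeroC ∷ [])) zeroC
parityC = precC zeroC (compC isZeroC (projC (# 1) ∷ []))
halfC   = precC zeroC (compC addC (projC (# 1) ∷ compC parityC (projC (# 0) ∷ []) ∷ []))
  where
    addC : Code 2
    addC = precC (projC (# 0)) (compC succC (projC (# 1) ∷ []))

ifZeroC : Code 3
ifZeroC = precC (projC (# 0)) (projC (# 3))

module _ {o : Baire} where
  eval-isZero : (x : ℕ) → Eval o isZeroC (x ∷ []) (isZero x)
  eval-isZero zero    = evPrec0 (evComp (evZero ∷ []) evSucc)
  eval-isZero (suc x) = evPrecS (eval-isZero x) evZero

  eval-parity : (x : ℕ) → Eval o parityC (x ∷ []) (parity x)
  eval-parity zero    = evPrec0 evZero
  eval-parity (suc x) = evPrecS (eval-parity x) (evComp (evProj ∷ []) (eval-isZero (parity x)))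

  eval-half : (x : ℕ) → Eval o halfC (x ∷ []) (half x)
  eval-half zero    = evPrec0 evZero
  eval-half (suc x) =
    evPrecS (eval-half x) (evComp (evProj ∷ evComp (evProj ∷ []) (eval-parity x) ∷ []) (eval-add (half x)))
    where
      eval-add : (a : ℕ) {b : ℕ} → Eval o _ (a ∷ b ∷ []) (a + b)
      eval-add zero    = evPrec0 evProj
      eval-add (suc a) = evPrecS (eval-add a) (evComp (evProj ∷ []) evSucc)

  eval-ifZero : (r a b : ℕ) → Eval o ifZeroC (r ∷ a ∷ b ∷ []) (ifZero r a b)
  eval-ifZero zero    a b = evPrec0 evProj
  eval-ifZero (suc r) a b = evPrecS (eval-ifZero r a b) evProj

⊕-lub : f ≤T h → g ≤T h → (f ⊕ g) ≤T h
⊕-lub {f} {h} {g} (cf , cf-computes-f) (cg , cg-computes-g) = joinC , λ n →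
  subst (Eval h joinC (n ∷ [])) (sym (⊕-as-ifZero f g n))
    (evComp (eval-parity n
              ∷ evComp (eval-half n ∷ []) (cf-computes-f (half n))
              ∷ evComp (eval-half n ∷ []) (cg-computes-g (half n)) ∷ [])
            (eval-ifZero (parity n) (f (half n)) (g (half n))))
  where
    joinC : Code 1
    joinC = compC ifZeroC (parityC ∷ compC cf (halfC ∷ []) ∷ compC cg (halfC ∷ []) ∷ [])

≼-refl : {s : BinStr} → s ≼ s
≼-refl = Prefix.fromPointwise (Pointwise.refl refl)

≼-reflexive : {s t : BinStr} → s ≡ t → s ≼ t
≼-reflexive refl = ≼-refl

≼⇒++ : {s t : BinStr} → s ≼ t → Σ BinStr λ r → s ++ r ≡ t
≼⇒++ s≼t with Prefix-as-∣ˡ s≼t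
... | r , s++r≡t = r , s++r≡t

module SplittingClass (em : ExcludedMiddle 0ℓ) (A : Class) (splitting : IsSplittingClass A) where

  private
    variable
      a x y z : Baire
      b : Bool
      τ : BinStr
      n N : ℕ

  downClosed : DownClosed A
  downClosed = proj₁ (proj₂ (proj₂ splitting))

  Incompatible : Baire → Baire → Set
  Incompatible g h = ∀ {z} → A z → g ≤T z → h ≤T z → ⊥

  join∉A⇒incompatible : ¬ A (g ⊕ h) → Incompatible g h
  join∉A⇒incompatible {g} {h} g⊕h∉A {z} z∈A g≤z h≤z =
    g⊕h∉A (downClosed (g ⊕ h) z z∈A (⊕-lub g≤z h≤z))

  record SplitPair (f : Baire) (L : List Baire) : Set where
    field
      split        : Bool → Baire
      split∈A      : ∀ b → A (split b)
      above        : ∀ b → f ≤T split b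
      incompatible : Incompatible (split false) (split true)
      avoids       : g ∈ L → ¬ g ≤T f → ∀ b → Incompatible g (split b)

    -- If one half were below f it would be below the other half.
    strictlyAbove : ∀ b → ¬ split b ≤T f
    strictlyAbove false k≤f = incompatible (split∈A true) (≤T-trans k≤f (above true)) ≤T-refl
    strictlyAbove true  k≤f = incompatible (split∈A false) ≤T-refl (≤T-trans k≤f (above false))

  notBelow? : (f : Baire) → Decidable (λ g → ¬ g ≤T f)
  notBelow? f g = ¬? em

  splitAbove : A f → (L : List Baire) → All A L → SplitPair f L
  splitAbove {f} f∈A L L⊆A
    with proj₂ (proj₂ (proj₂ splitting)) f f∈A (filter (notBelow? f) L)
                (All.zip (filter⁺ (notBelow? f) L⊆A , all-filter (notBelow? f) L))
  ... | h₀ , h₁ , h₀∈A , h₁∈A , f≤h₀ , f≤h₁ , h₀⊕h₁∉A , filtered-avoided = record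
    { split        = λ b → if b then h₁ else h₀
    ; split∈A      = λ { false → h₀∈A ; true → h₁∈A }
    ; above        = λ { false → f≤h₀ ; true → f≤h₁ }
    ; incompatible = join∉A⇒incompatible h₀⊕h₁∉A
    ; avoids       = λ g∈L g≰f → avoided (All.lookup filtered-avoided (∈-filter⁺ (notBelow? f) g∈L g≰f))
    }
    where
      avoided : ¬ A (g ⊕ h₀) × ¬ A (g ⊕ h₁) → ∀ b → Incompatible g (if b then h₁ else h₀)
      avoided (g⊕h₀∉A , _) false = join∉A⇒incompatible g⊕h₀∉A
      avoided (_ , g⊕h₁∉A) true  = join∉A⇒incompatible g⊕h₁∉A

  enumeration : Σ (ℕ → Baire) λ e → ((n : ℕ) → A (e n)) ×
                  ((f : Baire) → A f → Σ ℕ λ n → e n ≗ f)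
  enumeration with proj₁ (proj₂ splitting)
  ... | inj₁ empty      = ⊥-elim (empty (proj₁ (proj₁ splitting)) (proj₂ (proj₁ splitting)))
  ... | inj₂ enumerated = enumerated

  enum : ℕ → Baire
  enum = proj₁ enumeration

  enum∈A : (n : ℕ) → A (enum n)
  enum∈A = proj₁ (proj₂ enumeration)

  index : A x → ℕ
  index {x} x∈A = proj₁ (proj₂ (proj₂ enumeration) x x∈A)

  ≤T-enum : (x∈A : A x) → x ≤T enum (index x∈A)
  ≤T-enum {x} x∈A = ≗⇒≤T (λ k → sym (proj₂ (proj₂ (proj₂ enumeration) x x∈A) k))

  enum-≤T : (x∈A : A x) → enum (index x∈A) ≤T x
  enum-≤T {x} x∈A = ≗⇒≤T (proj₂ (proj₂ (proj₂ enumeration) x x∈A))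

  Marker : Set
  Marker = Baire × BinStr

  label : List Marker → Baire → BinStr
  label []              x = []
  label ((m , τ) ∷ ms) x with em {m ≤T x}
  ... | yes _ = τ
  ... | no  _ = label ms x

  label-cases : (ms : List Marker) (x : Baire) →
    label ms x ≡ [] ⊎ Σ Marker λ (m , τ) → (m , τ) ∈ ms × m ≤T x × label ms x ≡ τ
  label-cases []             x = inj₁ refl
  label-cases ((m , τ) ∷ ms) x with em {m ≤T x}
  ... | yes m≤x = inj₂ ((m , τ) , here refl , m≤x , refl)
  ... | no  _ with label-cases ms x
  ...   | inj₁ unlabelled              = inj₁ unlabelled
  ...   | inj₂ (p , p∈ms , m≤x , ≡τ) = inj₂ (p , there p∈ms , m≤x , ≡τ)

  label-≡T : (ms : List Marker) → x ≤T y → y ≤T x → label ms x ≡ label ms y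
  label-≡T []             x≤y y≤x = refl
  label-≡T {x} {y} ((m , τ) ∷ ms) x≤y y≤x with em {m ≤T x} | em {m ≤T y}
  ... | yes _   | yes _   = refl
  ... | yes m≤x | no  m≰y = ⊥-elim (m≰y (≤T-trans m≤x x≤y))
  ... | no  m≰x | yes m≤y = ⊥-elim (m≰x (≤T-trans m≤y y≤x))
  ... | no  _   | no  _   = label-≡T ms x≤y y≤x

  record Stage : Set where
    field
      markers : List Marker
      pool    : List Baire
      pool⊆A  : All A pool

  open Stage

  mutual
    stage : ℕ → Stage
    stage zero    = record { markers = [] ; pool = [] ; pool⊆A = [] }
    stage (suc n) = record
      { markers = (split false , σ n ∷ʳ false) ∷ (split true , σ n ∷ʳ true) ∷ markers (stage n)
      ; pool    = split false ∷ split true ∷ enum n ∷ pool (stage n)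
      ; pool⊆A  = split∈A false ∷ split∈A true ∷ enum∈A n ∷ pool⊆A (stage n) }
      where open SplitPair (splitAt n)

    splitAt : (n : ℕ) → SplitPair (enum n) (pool (stage n))
    splitAt n = splitAbove (enum∈A n) (pool (stage n)) (pool⊆A (stage n))

    σ : ℕ → BinStr
    σ n = label (markers (stage n)) (enum n)

  branch : ℕ → Bool → Baire
  branch n = SplitPair.split (splitAt n)

  labelAt : ℕ → Baire → BinStr
  labelAt n = label (markers (stage n))

  branch∈A : (n : ℕ) (b : Bool) → A (branch n b)
  branch∈A n = SplitPair.split∈A (splitAt n)

  enum∈pool : (n : ℕ) → enum n ∈ pool (stage (suc n))
  enum∈pool n = there (there (here refl))

  branch∈pool : (n : ℕ) (b : Bool) → branch n b ∈ pool (stage (suc n))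
  branch∈pool n false = here refl
  branch∈pool n true  = there (here refl)

  pool-mono : a ∈ pool (stage n) → n ≤′ N → a ∈ pool (stage N)
  pool-mono a∈pool ≤′-refl       = a∈pool
  pool-mono a∈pool (≤′-step n≤N) = there (there (there (pool-mono a∈pool n≤N)))

  marker∈pool : (n : ℕ) → (a , τ) ∈ markers (stage n) → a ∈ pool (stage n)
  marker∈pool (suc n) (here refl)         = here refl
  marker∈pool (suc n) (there (here refl)) = there (here refl)
  marker∈pool (suc n) (there (there m))   = there (there (there (marker∈pool n m)))

  branch-not-below-pool : x ≤T y → y ∈ pool (stage n) → ∀ b → ¬ branch n b ≤T x
  branch-not-below-pool {x} {y} {n} x≤y y∈pool b k≤x with em {y ≤T enum n}
  ... | yes y≤e = SplitPair.strictlyAbove (splitAt n) b (≤T-trans k≤x (≤T-trans x≤y y≤e))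
  ... | no  y≰e = SplitPair.avoids (splitAt n) y∈pool y≰e b
                    (All.lookup (pool⊆A (stage n)) y∈pool) ≤T-refl (≤T-trans k≤x x≤y)

  branch-dichotomy : A z → (Σ Bool λ b → branch n b ≤T z) ⊎ (∀ b → ¬ branch n b ≤T z)
  branch-dichotomy {z} {n} z∈A with em {branch n false ≤T z} | em {branch n true ≤T z}
  ... | yes k≤z | _       = inj₁ (false , k≤z)
  ... | no  _   | yes k≤z = inj₁ (true , k≤z)
  ... | no  k≰z | no  k′≰z = inj₂ λ { false → k≰z ; true → k′≰z }

  labelAt-suc-above : A z → branch n b ≤T z → labelAt (suc n) z ≡ σ n ∷ʳ b
  labelAt-suc-above {z} {n} {b} z∈A k≤z with em {branch n false ≤T z} | b
  ... | yes _    | false = refl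
  ... | yes k₀≤z | true  = ⊥-elim (SplitPair.incompatible (splitAt n) z∈A k₀≤z k≤z)
  ... | no  k₀≰z | false = ⊥-elim (k₀≰z k≤z)
  ... | no  _    | true with em {branch n true ≤T z}
  ...   | yes _    = refl
  ...   | no  k₁≰z = ⊥-elim (k₁≰z k≤z)

  labelAt-suc-below : (∀ b → ¬ branch n b ≤T x) → labelAt (suc n) x ≡ labelAt n x
  labelAt-suc-below {n} {x} k≰x with em {branch n false ≤T x}
  ... | yes k₀≤x = ⊥-elim (k≰x false k₀≤x)
  ... | no  _ with em {branch n true ≤T x}
  ...   | yes k₁≤x = ⊥-elim (k≰x true k₁≤x)
  ...   | no  _    = refl

  labelAt-stable : x ≤T y → y ∈ pool (stage n) → n ≤′ N → labelAt N x ≡ labelAt n x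
  labelAt-stable x≤y y∈pool ≤′-refl       = refl
  labelAt-stable x≤y y∈pool (≤′-step n≤N) =
    trans (labelAt-suc-below (branch-not-below-pool x≤y (pool-mono y∈pool n≤N)))
          (labelAt-stable x≤y y∈pool n≤N)

  marker-below : (n : ℕ) → A z → (a , τ) ∈ markers (stage n) → a ≤T z → τ ≼ labelAt n z
  marker-below (suc n) z∈A (here refl) k≤z =
    ≼-reflexive (sym (labelAt-suc-above z∈A k≤z))
  marker-below (suc n) z∈A (there (here refl)) k≤z =
    ≼-reflexive (sym (labelAt-suc-above z∈A k≤z))
  marker-below {z} {a} {τ} (suc n) z∈A (there (there m)) a≤z with branch-dichotomy {n = n} z∈A
  ... | inj₂ k≰z = subst (τ ≼_) (sym (labelAt-suc-below k≰z)) (marker-below n z∈A m a≤z)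
  ... | inj₁ (b , k≤z) =
    subst (τ ≼_) (sym (labelAt-suc-above z∈A k≤z)) (below-σ ++ᵖ (b ∷ []))
    where
      -- An older marker below z that is not below enum n would be incompatible
      -- with the branch below z.
      below-σ : τ ≼ σ n
      below-σ with em {a ≤T enum n}
      ... | yes a≤e = marker-below n (enum∈A n) m a≤e
      ... | no  a≰e = ⊥-elim (SplitPair.avoids (splitAt n) (marker∈pool n m) a≰e b z∈A a≤z k≤z)

  labelAt-mono : (n : ℕ) → A y → x ≤T y → labelAt n x ≼ labelAt n y
  labelAt-mono {y} {x} n y∈A x≤y with label-cases (markers (stage n)) x
  ... | inj₁ unlabelled = subst (_≼ labelAt n y) (sym unlabelled) []
  ... | inj₂ (_ , m∈ms , m≤x , ≡τ) =
    subst (_≼ labelAt n y) (sym ≡τ) (marker-below n y∈A m∈ms (≤T-trans m≤x x≤y))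

  α : Elem A → BinStr
  α (x , x∈A) = labelAt (suc (index x∈A)) x

  α-eventually : (x∈A : A x) → suc (index x∈A) ≤′ N → labelAt N x ≡ α (x , x∈A)
  α-eventually x∈A = labelAt-stable (≤T-enum x∈A) (enum∈pool (index x∈A))

  α≡labelAt : (n : ℕ) (x∈A : A x) → x ≤T y → y ∈ pool (stage n) → α (x , x∈A) ≡ labelAt n x
  α≡labelAt n x∈A x≤y y∈pool =
    trans (sym (α-eventually x∈A (≤⇒≤′ (m≤m⊔n (suc (index x∈A)) n))))
          (labelAt-stable x≤y y∈pool (≤⇒≤′ (m≤n⊔m (suc (index x∈A)) n)))

  α-mono : (x∈A : A x) (y∈A : A y) → x ≤T y → α (x , x∈A) ≼ α (y , y∈A)
  α-mono x∈A y∈A x≤y =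
    subst₂ _≼_ (α-eventually x∈A (≤⇒≤′ (m≤m⊔n (suc (index x∈A)) (suc (index y∈A)))))
               (α-eventually y∈A (≤⇒≤′ (m≤n⊔m (suc (index x∈A)) (suc (index y∈A)))))
               (labelAt-mono (suc (index x∈A) ⊔ suc (index y∈A)) y∈A x≤y)

  α≡σ : (x∈A : A x) → α (x , x∈A) ≡ σ (index x∈A)
  α≡σ x∈A = trans (labelAt-suc-below λ b k≤x →
                     SplitPair.strictlyAbove (splitAt (index x∈A)) b (≤T-trans k≤x (≤T-enum x∈A)))
                  (label-≡T (markers (stage (index x∈A))) (≤T-enum x∈A) (enum-≤T x∈A))

  α-branch : α (branch n b , branch∈A n b) ≡ σ n ∷ʳ b
  α-branch {n} {b} = trans (α≡labelAt (suc n) (branch∈A n b) ≤T-refl (branch∈pool n b))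
                           (labelAt-suc-above {n = n} (branch∈A n b) ≤T-refl)

  α-root : α (enum 0 , enum∈A 0) ≡ []
  α-root = trans (α≡labelAt 1 (enum∈A 0) ≤T-refl (enum∈pool 0))
                 (labelAt-suc-below {n = 0} (SplitPair.strictlyAbove (splitAt 0)))

  ≤T-branch : (x∈A : A x) (b : Bool) → x ≤T branch (index x∈A) b
  ≤T-branch x∈A = ≤T-trans (≤T-enum x∈A) ∘ SplitPair.above (splitAt (index x∈A))

  α-branch-child : (x∈A : A x) (b : Bool) →
    α (branch (index x∈A) b , branch∈A (index x∈A) b) ≡ α (x , x∈A) ∷ʳ b
  α-branch-child x∈A b = trans α-branch (cong (_∷ʳ b) (sym (α≡σ x∈A)))

  α-extend : (x∈A : A x) (r : BinStr) →
    Σ (Elem A) λ w → x ≤T proj₁ w × α w ≡ α (x , x∈A) ++ r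
  α-extend x∈A []      = (_ , x∈A) , ≤T-refl , sym (++-identityʳ _)
  α-extend x∈A (b ∷ r) =
    let (w , k≤w , αw≡) = α-extend (branch∈A (index x∈A) b) r
    in w , ≤T-trans (≤T-branch x∈A b) k≤w ,
       (begin
         α w                            ≡⟨ αw≡ ⟩
         α (_ , branch∈A _ b) ++ r      ≡⟨ cong (_++ r) (α-branch-child x∈A b) ⟩
         α (_ , x∈A) ∷ʳ b ++ r          ≡⟨ ++-assoc (α (_ , x∈A)) (b ∷ []) r ⟩
         α (_ , x∈A) ++ b ∷ r           ∎)
    where open ≡.≡-Reasoning

  α-surjective : (s : BinStr) → Σ (Elem A) λ w → α w ≡ s
  α-surjective s with α-extend (enum∈A 0) s
  ... | w , _ , αw≡ = w , trans αw≡ (cong (_++ s) α-root)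

  α-back : (x∈A : A x) {t : BinStr} → α (x , x∈A) ≼ t →
    Σ (Elem A) λ w → x ≤T proj₁ w × α w ≡ t
  α-back x∈A α≼t with ≼⇒++ α≼t
  ... | r , α++r≡t with α-extend x∈A r
  ...   | w , x≤w , αw≡ = w , x≤w , trans αw≡ α++r≡t

  α-isPMorphism : IsPMorphism (ElemLe A) _≼_ α
  α-isPMorphism = record
    { surjective = α-surjective
    ; monotone   = λ { (x , x∈A) (y , y∈A) → α-mono x∈A y∈A }
    ; back       = λ { (x , x∈A) t → α-back x∈A }
    }

proposition5p6 : ExcludedMiddle 0ℓ → (A : Class) → IsSplittingClass A →
    Σ (Elem A → BinStr) λ α → IsPMorphism (ElemLe A) _≼_ α
proposition5p6 em A splitting = α , α-isPMorphism
  where open SplittingClass em A splitting
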